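{- For all nonnegative integers $h,k$, $$D_q(h+1,k+1)=D_q(h+1,k)+q^{k+1}D_q(h,k+1)+q^{k+1}D_q(h,k).$$
   Context: The $q$-integer is $[m]_q=(1-q^m)/(1-q)$ and the $q$-binomial coefficient is $\left[{h\atop k}\right]_q=\frac{[h]_q[h-1]_q\cdots[h-k+1]_q}{[k]_q[k-1]_q\cdots[1]_q}$, with $\left[{h\atop 0}\right]_q=1$ and $\left[{h\atop k}\right]_q=0$ for $k<0$. For nonnegative integers $h,k$ the $q$-Delannoy number is $D_q(h,k)=\sum_{j=0}^{h}q^{\binom{j+1}{2}}\left[{k\atop j}\right]_q\left[{h+k-j\atop k}\right]_q$. -}

module Defs where

open import Data.Nat as ℕ using (ℕ; zero; suc; _∸_)
open import Algebra.Bundles using (CommutativeRing)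
open import Level using (Level)

-- Everything is defined over an arbitrary commutative ring R and element q : R.
-- Taking R = ℤ[q] recovers the polynomial identity in the indeterminate q.
module QDefs {c ℓ : Level} (R : CommutativeRing c ℓ) where
  open CommutativeRing R using (Carrier; _+_; _*_; 0#; 1#)

  pow : Carrier → ℕ → Carrier
  pow q zero    = 1#
  pow q (suc n) = q * pow q n

  tri : ℕ → ℕ
  tri zero    = zero
  tri (suc j) = suc j ℕ.+ tri j

  -- Gaussian (q-)binomial coefficient [h choose k]_q, as a polynomial in q,
  -- via the q-Pascal recurrence (equal to the ratio of q-factorial products);
  -- [h choose k] = 0 for k > h, [h choose 0] = 1.
  qbin : Carrier → ℕ → ℕ → Carrier
  qbin q h       zero    = 1#
  qbin q zero    (suc k) = 0#
  qbin q (suc h) (suc k) = qbin q h k + pow q (suc k) * qbin q h (suc k)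

  sumTo : ℕ → (ℕ → Carrier) → Carrier
  sumTo zero    f = f zero
  sumTo (suc n) f = sumTo n f + f (suc n)

  Dq : Carrier → ℕ → ℕ → Carrier
  Dq q h k = sumTo h (λ j → pow q (tri j) * (qbin q k j * qbin q ((h ℕ.+ k) ∸ j) k))

{-# OPTIONS --safe #-}
-- Put D′(n,k) = Σ_{j≤n} q^binom(j+1,2) [k j] [n+k−j, k+1]. As q^binom(j+1,2) = q^j q^binom(j,2),
-- the second q-Pascal rule q^j [k+1, j] = q^j [k, j] + q^(k+1) [k, j−1], applied to the first
-- binomial of D(n,k+1), gives D(n,k+1) = D′(n+1,k) + q^(k+1) D′(n,k); the defining q-Pascal rule,
-- applied to the second binomial of D′(n+1,k), gives D′(n+1,k) = D(n,k) + q^(k+1) D′(n,k).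
-- (Boundary terms j = n+1 vanish since [k, k+1] = 0.) Eliminating D′ between n = h and
-- n = h+1 gives the recurrence.
module Submission where

open import Defs
open import Data.Nat using (ℕ; zero; suc; _∸_; _≤_; _<_; s≤s)
import Data.Nat as ℕ
import Data.Nat.Properties as ℕₚ
open import Level using (Level)
open import Algebra.Bundles using (CommutativeRing)
import Relation.Binary.PropositionalEquality as ≡
import Relation.Binary.Reasoning.Setoid as SetoidReasoning
import Algebra.Solver.Ring.NaturalCoefficients.Default as RingSolver

module QDelannoy {c ℓ : Level} (R : CommutativeRing c ℓ) (q : CommutativeRing.Carrier R) where
  open CommutativeRing R hiding (zero)
  open QDefs R
  open SetoidReasoning setoid
  open RingSolver commutativeSemiring using (solve; _:=_; _:+_; _:*_; con)
  open import Algebra.Properties.CommutativeSemigroup +-commutativeSemigroup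
    using () renaming (interchange to +-interchange)

  pow-distribˡ-+-* : ∀ m n → pow q (m ℕ.+ n) ≈ pow q m * pow q n
  pow-distribˡ-+-* zero    n = sym (*-identityˡ _)
  pow-distribˡ-+-* (suc m) n = trans (*-congˡ (pow-distribˡ-+-* m n)) (sym (*-assoc _ _ _))

  n<k⇒qbin≈0 : ∀ {n k} → n < k → qbin q n k ≈ 0#
  n<k⇒qbin≈0 {zero}  {suc k} _         = refl
  n<k⇒qbin≈0 {suc n} {suc k} (s≤s n<k) = begin
    qbin q n k + pow q (suc k) * qbin q n (suc k)
      ≈⟨ +-cong (n<k⇒qbin≈0 n<k) (*-congˡ (n<k⇒qbin≈0 (ℕₚ.m<n⇒m<1+n n<k))) ⟩
    0# + pow q (suc k) * 0#
      ≈⟨ trans (+-identityˡ _) (zeroʳ _) ⟩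
    0# ∎

  qbin-suc-∸ : ∀ {m j} l → j ≤ m →
    qbin q (suc m ∸ j) (suc l) ≈ qbin q (m ∸ j) l + pow q (suc l) * qbin q (m ∸ j) (suc l)
  qbin-suc-∸ l j≤m = reflexive (≡.cong (λ t → qbin q t (suc l)) (ℕₚ.+-∸-assoc 1 j≤m))

  -- The second q-Pascal rule, multiplied by q^(i+1) so that the exponent n − i never appears.
  qbin-pascal₂ : ∀ n i →
    pow q (suc i) * qbin q (suc n) (suc i) ≈ pow q (suc i) * qbin q n (suc i) + pow q (suc n) * qbin q n i
  qbin-pascal₂ zero zero =
    solve 1 (λ p → p :* (con 1 :+ p :* con 0) := p :* con 0 :+ p :* con 1) refl (pow q 1)
  qbin-pascal₂ zero (suc i) =
    solve 2 (λ p r → p :* (con 0 :+ p :* con 0) := p :* con 0 :+ r :* con 0) refl (pow q (suc (suc i))) (pow q 1)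
  qbin-pascal₂ (suc n) zero = begin
    q * 1# * (1# + q * 1# * qbin q (suc n) 1)
      ≈⟨ *-congˡ (+-congˡ (qbin-pascal₂ n zero)) ⟩
    q * 1# * (1# + (q * 1# * qbin q n 1 + pow q (suc n) * 1#))
      ≈⟨ solve 3 (λ x b r → x :* con 1 :* (con 1 :+ (x :* con 1 :* b :+ r :* con 1))
                       := x :* con 1 :* (con 1 :+ x :* con 1 :* b) :+ x :* r :* con 1)
               refl q (qbin q n 1) (pow q (suc n)) ⟩
    q * 1# * (1# + q * 1# * qbin q n 1) + q * pow q (suc n) * 1# ∎
  qbin-pascal₂ (suc n) (suc i) = begin
    q * P * (qbin q (suc n) (suc i) + q * P * qbin q (suc n) (suc (suc i)))
      ≈⟨ solve 4 (λ x p a b → x :* p :* (a :+ x :* p :* b) := x :* (p :* a) :+ x :* p :* (x :* p :* b))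
               refl q P (qbin q (suc n) (suc i)) (qbin q (suc n) (suc (suc i))) ⟩
    q * (P * qbin q (suc n) (suc i)) + q * P * (q * P * qbin q (suc n) (suc (suc i)))
      ≈⟨ +-cong (*-congˡ (qbin-pascal₂ n i)) (*-congˡ (qbin-pascal₂ n (suc i))) ⟩
    q * (P * b + Q * a) + q * P * (q * P * e + Q * b)
      ≈⟨ solve 6 (λ x p r a b e → x :* (p :* b :+ r :* a) :+ x :* p :* (x :* p :* e :+ r :* b)
                            := x :* p :* (b :+ x :* p :* e) :+ x :* r :* (a :+ p :* b))
               refl q P Q a b e ⟩
    q * P * (b + q * P * e) + q * Q * (a + P * b) ∎
    where
      P Q a b e : Carrier
      P = pow q (suc i)
      Q = pow q (suc n)
      a = qbin q n i
      b = qbin q n (suc i)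
      e = qbin q n (suc (suc i))

  sumTo-cong : ∀ n {f g : ℕ → Carrier} → (∀ j → j ≤ n → f j ≈ g j) → sumTo n f ≈ sumTo n g
  sumTo-cong zero    f≈g = f≈g 0 ℕ.z≤n
  sumTo-cong (suc n) f≈g =
    +-cong (sumTo-cong n (λ j j≤n → f≈g j (ℕₚ.m≤n⇒m≤1+n j≤n))) (f≈g (suc n) ℕₚ.≤-refl)

  sumTo-+ : ∀ n (f g : ℕ → Carrier) → sumTo n (λ j → f j + g j) ≈ sumTo n f + sumTo n g
  sumTo-+ zero    f g = refl
  sumTo-+ (suc n) f g = trans (+-congʳ (sumTo-+ n f g)) (+-interchange _ _ _ _)

  sumTo-*ˡ : ∀ n x (f : ℕ → Carrier) → sumTo n (λ j → x * f j) ≈ x * sumTo n f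
  sumTo-*ˡ zero    x f = refl
  sumTo-*ˡ (suc n) x f = trans (+-congʳ (sumTo-*ˡ n x f)) (sym (distribˡ x _ _))

  sumTo-suc-first : ∀ n (f : ℕ → Carrier) → sumTo (suc n) f ≈ f 0 + sumTo n (λ j → f (suc j))
  sumTo-suc-first zero    f = refl
  sumTo-suc-first (suc n) f = trans (+-congʳ (sumTo-suc-first n f)) (+-assoc _ _ _)

  weightedSum : ℕ → ℕ → (ℕ → Carrier) → Carrier
  weightedSum K n g = sumTo n (λ j → pow q (tri j) * (qbin q K j * g j))

  weightedSum-linear : ∀ K n {g g₁ g₂ : ℕ → Carrier} x → (∀ j → j ≤ n → g j ≈ g₁ j + x * g₂ j) →
    weightedSum K n g ≈ weightedSum K n g₁ + x * weightedSum K n g₂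
  weightedSum-linear K n {g} {g₁} {g₂} x g≈ = begin
    weightedSum K n g
      ≈⟨ sumTo-cong n (λ j j≤n → trans (*-congˡ (*-congˡ (g≈ j j≤n))) (distribute _ _ _ _)) ⟩
    sumTo n (λ j → pow q (tri j) * (qbin q K j * g₁ j) + x * (pow q (tri j) * (qbin q K j * g₂ j)))
      ≈⟨ trans (sumTo-+ n _ _) (+-congˡ (sumTo-*ˡ n x _)) ⟩
    weightedSum K n g₁ + x * weightedSum K n g₂ ∎
    where
      distribute : ∀ t b y z → t * (b * (y + x * z)) ≈ t * (b * y) + x * (t * (b * z))
      distribute t b y z =
        solve 5 (λ t b y z x → t :* (b :* (y :+ x :* z)) := t :* (b :* y) :+ x :* (t :* (b :* z))) refl t b y z x

  weightedSum-dropLast : ∀ K n {g : ℕ → Carrier} → g (suc n) ≈ 0# → weightedSum K (suc n) g ≈ weightedSum K n g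
  weightedSum-dropLast K n g≈0 =
    trans (+-congˡ (trans (*-congˡ (trans (*-congˡ g≈0) (zeroʳ _))) (zeroʳ _))) (+-identityʳ _)

  weightedSum-lower : ∀ K n (g : ℕ → Carrier) →
    weightedSum (suc K) (suc n) g ≈ weightedSum K (suc n) g + pow q (suc K) * weightedSum K n (λ j → g (suc j))
  weightedSum-lower K n g = begin
    weightedSum (suc K) (suc n) g
      ≈⟨ sumTo-suc-first n _ ⟩
    term K g 0 + sumTo n (λ i → term (suc K) g (suc i))
      ≈⟨ +-congˡ (sumTo-cong n (λ i _ → term-lower i)) ⟩
    term K g 0 + sumTo n (λ i → term K g (suc i) + Q * term K g′ i)
      ≈⟨ +-congˡ (trans (sumTo-+ n _ _) (+-congˡ (sumTo-*ˡ n Q _))) ⟩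
    term K g 0 + (sumTo n (λ i → term K g (suc i)) + Q * weightedSum K n g′)
      ≈⟨ trans (sym (+-assoc _ _ _)) (+-congʳ (sym (sumTo-suc-first n (term K g)))) ⟩
    weightedSum K (suc n) g + Q * weightedSum K n g′ ∎
    where
      Q : Carrier
      Q = pow q (suc K)
      g′ : ℕ → Carrier
      g′ j = g (suc j)
      term : ℕ → (ℕ → Carrier) → ℕ → Carrier
      term L f j = pow q (tri j) * (qbin q L j * f j)
      term-lower : ∀ i → term (suc K) g (suc i) ≈ term K g (suc i) + Q * term K g′ i
      term-lower i = begin
        pow q (tri (suc i)) * (qbin q (suc K) (suc i) * x)
          ≈⟨ *-congʳ (pow-distribˡ-+-* (suc i) (tri i)) ⟩
        P * T * (qbin q (suc K) (suc i) * x)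
          ≈⟨ solve 4 (λ p t a x → p :* t :* (a :* x) := t :* x :* (p :* a)) refl P T (qbin q (suc K) (suc i)) x ⟩
        T * x * (P * qbin q (suc K) (suc i))
          ≈⟨ *-congˡ (qbin-pascal₂ K i) ⟩
        T * x * (P * qbin q K (suc i) + Q * qbin q K i)
          ≈⟨ solve 6 (λ p t b c x r → t :* x :* (p :* b :+ r :* c) := p :* t :* (b :* x) :+ r :* (t :* (c :* x)))
                   refl P T (qbin q K (suc i)) (qbin q K i) x Q ⟩
        P * T * (qbin q K (suc i) * x) + Q * term K g′ i
          ≈⟨ +-congʳ (*-congʳ (sym (pow-distribˡ-+-* (suc i) (tri i)))) ⟩
        term K g (suc i) + Q * term K g′ i ∎
        where
          P T x : Carrier
          P = pow q (suc i)
          T = pow q (tri i)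
          x = g (suc i)

  Dq′ : ℕ → ℕ → Carrier
  Dq′ n k = weightedSum k n (λ j → qbin q ((n ℕ.+ k) ∸ j) (suc k))

  qbin[n+k∸n][1+k]≈0 : ∀ n k → qbin q ((n ℕ.+ k) ∸ n) (suc k) ≈ 0#
  qbin[n+k∸n][1+k]≈0 n k = n<k⇒qbin≈0 (s≤s (ℕₚ.≤-reflexive (ℕₚ.m+n∸m≡n n k)))

  Dq-sucʳ : ∀ n k → Dq q n (suc k) ≈ Dq′ (suc n) k + pow q (suc k) * Dq′ n k
  Dq-sucʳ n k = begin
    Dq q n (suc k)
      ≡⟨ ≡.cong (λ m → weightedSum (suc k) n (λ j → qbin q (m ∸ j) (suc k))) (ℕₚ.+-suc n k) ⟩
    weightedSum (suc k) n g
      ≈⟨ weightedSum-dropLast (suc k) n (qbin[n+k∸n][1+k]≈0 n k) ⟨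
    weightedSum (suc k) (suc n) g
      ≈⟨ weightedSum-lower k n g ⟩
    Dq′ (suc n) k + pow q (suc k) * Dq′ n k ∎
    where
      g : ℕ → Carrier
      g j = qbin q (suc (n ℕ.+ k) ∸ j) (suc k)

  Dq′-suc : ∀ n k → Dq′ (suc n) k ≈ Dq q n k + pow q (suc k) * Dq′ n k
  Dq′-suc n k = begin
    Dq′ (suc n) k
      ≈⟨ weightedSum-dropLast k n (qbin[n+k∸n][1+k]≈0 n k) ⟩
    weightedSum k n (λ j → qbin q (suc (n ℕ.+ k) ∸ j) (suc k))
      ≈⟨ weightedSum-linear k n (pow q (suc k)) (λ j j≤n → qbin-suc-∸ k (ℕₚ.≤-trans j≤n (ℕₚ.m≤m+n n k))) ⟩
    Dq q n k + pow q (suc k) * Dq′ n k ∎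

  Dq-recurrence : ∀ h k →
    Dq q (suc h) (suc k) ≈ Dq q (suc h) k + (pow q (suc k) * Dq q h (suc k) + pow q (suc k) * Dq q h k)
  Dq-recurrence h k = begin
    Dq q (suc h) (suc k)
      ≈⟨ Dq-sucʳ (suc h) k ⟩
    Dq′ (suc (suc h)) k + Q * Dq′ (suc h) k
      ≈⟨ trans (+-congʳ (Dq′-suc (suc h) k)) (+-assoc _ _ _) ⟩
    Dq q (suc h) k + (Q * Dq′ (suc h) k + Q * Dq′ (suc h) k)
      ≈⟨ +-congˡ (+-congˡ (*-congˡ (Dq′-suc h k))) ⟩
    Dq q (suc h) k + (Q * Dq′ (suc h) k + Q * (Dq q h k + Q * Dq′ h k))
      ≈⟨ +-congˡ (solve 4 (λ r y d x → r :* y :+ r :* (d :+ r :* x) := r :* (y :+ r :* x) :+ r :* d)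
                           refl Q (Dq′ (suc h) k) (Dq q h k) (Dq′ h k)) ⟩
    Dq q (suc h) k + (Q * (Dq′ (suc h) k + Q * Dq′ h k) + Q * Dq q h k)
      ≈⟨ +-congˡ (+-congʳ (*-congˡ (Dq-sucʳ h k))) ⟨
    Dq q (suc h) k + (Q * Dq q h (suc k) + Q * Dq q h k) ∎
    where
      Q : Carrier
      Q = pow q (suc k)

open CommutativeRing using (Carrier; _≈_; _+_; _*_)
open QDefs using (Dq; pow)

mainTheorem4 : {c ℓ : Level} (R : CommutativeRing c ℓ) (q : Carrier R) (h k : ℕ) →
    _≈_ R (Dq R q (suc h) (suc k))
          (_+_ R (Dq R q (suc h) k)
                 (_+_ R (_*_ R (pow R q (suc k)) (Dq R q h (suc k)))
                        (_*_ R (pow R q (suc k)) (Dq R q h k))))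
mainTheorem4 R q = QDelannoy.Dq-recurrence R q
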